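{- Let $k\ge 2$ be an integer and let $G$ be a triangle-free $k$-regular graph. Then $G$ is $k$-edge-colorable if and only if $\overline{L(G)}$ is localizable.
   Context: All graphs are finite, simple and undirected. $L(G)$ is the line graph of $G$ (vertex set $E(G)$, two edges adjacent iff they share an endpoint) and $\overline{L(G)}$ its complement. $G$ is $k$-edge-colorable if $E(G)$ is the union of $k$ matchings. A clique is strong if it intersects every maximal independent set; a graph is localizable if its vertex set can be partitioned into strong cliques. -}

module Defs where

open import Data.Nat using (ℕ; _≤_)
open import Data.Bool using (Bool; true; false; T)
open import Data.Fin using (Fin; _<_; _≟_)
open import Data.List using (List; length; filter; allFin)
open import Data.Product using (Σ; ∃; ∃-syntax; _×_; _,_; proj₁; proj₂)
open import Data.Sum using (_⊎_; inj₁; inj₂)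
open import Relation.Nullary using (¬_; Dec)
open import Relation.Nullary.Decidable using (⌊_⌋)
open import Relation.Unary using (Pred)
open import Relation.Binary.PropositionalEquality using (_≡_; refl) renaming (sym to ≡sym)

record AbsGraph (V : Set) : Set₁ where
  field
    Adj   : V → V → Set
    sym   : ∀ {x y} → Adj x y → Adj y x
    irr   : ∀ {x} → ¬ Adj x x

module _ {V : Set} (H : AbsGraph V) where
  open AbsGraph H using (Adj)

  Subset : Set
  Subset = V → Bool

  _⊆_ : Subset → Subset → Set
  S ⊆ S' = ∀ x → T (S x) → T (S' x)

  IsIndependent : Subset → Set
  IsIndependent S = ∀ x y → T (S x) → T (S y) → ¬ Adj x y

  IsMaximalIndependent : Subset → Set
  IsMaximalIndependent S =
    IsIndependent S × (∀ S' → IsIndependent S' → S ⊆ S' → S' ⊆ S)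

  IsClique : Subset → Set
  IsClique C = ∀ x y → T (C x) → T (C y) → ¬ (x ≡ y) → Adj x y

  IsStrongClique : Subset → Set
  IsStrongClique C =
    IsClique C × (∀ S → IsMaximalIndependent S → ∃[ x ] (T (C x) × T (S x)))

  -- A partition is
  -- given by a labelling f : V → Fin m whose classes are the parts
  -- (empty classes are harmless: they can be discarded / are never needed).
  Localizable : Set
  Localizable = ∃[ m ] Σ (V → Fin m) λ f →
    ∀ i → IsStrongClique (λ x → ⌊ f x ≟ i ⌋)

record Graph (n : ℕ) : Set where
  field
    adj   : Fin n → Fin n → Bool
    sym   : ∀ u v → adj u v ≡ adj v u
    irr   : ∀ v → adj v v ≡ false

module _ {n : ℕ} (G : Graph n) where
  open Graph G using (adj)

  degree : Fin n → ℕ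
  degree v = length (filter (λ u → Data.Bool._≟_ (adj v u) true) (allFin n))

  IsRegular : ℕ → Set
  IsRegular k = ∀ v → degree v ≡ k

  TriangleFree : Set
  TriangleFree = ∀ u v w → ¬ (T (adj u v) × T (adj v w) × T (adj u w))

  -- edges: unordered pairs {u,v}, represented with u < v
  Edge : Set
  Edge = Σ (Fin n × Fin n) λ p → (proj₁ p < proj₂ p) × T (adj (proj₁ p) (proj₂ p))

  ends : Edge → Fin n × Fin n
  ends e = proj₁ e

  ShareEnd : Edge → Edge → Set
  ShareEnd e f =
    let (a , b) = ends e ; (c , d) = ends f in
    (a ≡ c) ⊎ (a ≡ d) ⊎ (b ≡ c) ⊎ (b ≡ d)

  EdgeColorable : ℕ → Set
  EdgeColorable k = Σ (Edge → Fin k) λ c →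
    ∀ e f → ¬ (ends e ≡ ends f) → ShareEnd e f → ¬ (c e ≡ c f)

  shareSym : ∀ e f → ShareEnd e f → ShareEnd f e
  shareSym e f (inj₁ p) = inj₁ (≡sym p)
  shareSym e f (inj₂ (inj₁ p)) = inj₂ (inj₂ (inj₁ (≡sym p)))
  shareSym e f (inj₂ (inj₂ (inj₁ p))) = inj₂ (inj₁ (≡sym p))
  shareSym e f (inj₂ (inj₂ (inj₂ p))) = inj₂ (inj₂ (inj₂ (≡sym p)))

  LineComplement : AbsGraph Edge
  LineComplement = record
    { Adj = λ e f → ¬ (ends e ≡ ends f) × ¬ ShareEnd e f
    ; sym = λ {e} {f} p → (λ r → proj₁ p (≡sym r)) , (λ s → proj₂ p (shareSym f e s))
    ; irr = λ p → proj₁ p refl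
    }

-- In a triangle-free graph, a maximal family of pairwise intersecting edges (a maximal independent
-- set of the complement of L(G)) that contains the edge ab contains every edge at a or every edge
-- at b, and the full star of a vertex of degree at least two is such a maximal family.  Cliques of
-- the complement are matchings.  In a properly k-edge-coloured k-regular graph every colour appears
-- at every vertex, so each colour class meets every maximal family.  Conversely, every part of a
-- partition into strong cliques meets the star of a fixed vertex v, which has k edges; naming each
-- part by such an edge is a proper k-edge-colouring.
module Submission where

open import Defs
open import Data.Bool using (true; _∨_; T)
open import Data.Bool.Properties using (T-≡; T-∨; T-irrelevant)
import Data.Bool as Bool
open import Data.Empty using (⊥; ⊥-elim)
open import Data.Fin using (Fin; zero; suc; _<_; _≟_; punchOut)
open import Data.Fin.Properties
  using (<-cmp; <-asym; <-irrelevant; <⇒≢; any?; punchOut-injective; injective⇒≤)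
open import Data.List using (List; lookup; filter; allFin)
open import Data.List.Membership.Propositional.Properties using (∈-lookup; ∈-filter⁺; ∈-filter⁻; ∈-allFin)
open import Data.List.Relation.Unary.All as All using ()
open import Data.List.Relation.Unary.Any as Any using ()
open import Data.List.Relation.Unary.Any.Properties using (lookup-index)
open import Data.List.Relation.Unary.Unique.Propositional using (Unique)
open import Data.List.Relation.Unary.Unique.Propositional.Properties using (allFin⁺; filter⁺)
open import Data.List.Relation.Unary.AllPairs using (_∷_)
open import Data.Nat as ℕ using (ℕ; _≤_; s≤s)
open import Data.Nat.Properties using (≤-reflexive; <⇒≱)
open import Data.Product using (∃; ∃₂; _×_; _,_; proj₁; proj₂)
open import Data.Product.Properties using (≡-dec)
open import Data.Sum using (_⊎_; inj₁; inj₂; [_,_]′)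
import Data.Sum as Sum
open import Function using (_∘_)
open import Function.Bundles using (Equivalence)
open import Function.Definitions using (Injective)
open import Relation.Binary.Definitions using (DecidableEquality; tri<; tri≈; tri>)
open import Relation.Binary.PropositionalEquality using (_≡_; _≢_; refl; sym; trans; cong; cong₂; subst; module ≡-Reasoning)
open import Relation.Nullary using (¬_; Dec; yes; no; contradiction)
open import Relation.Nullary.Decidable using (⌊_⌋; T?; toWitness; fromWitness; _⊎-dec_; map′; decidable-stable)
open import Relation.Unary using (Decidable)

lookup-injective : ∀ {A : Set} {xs : List A} → Unique xs → Injective _≡_ _≡_ (lookup xs)
lookup-injective (_ ∷ _) {zero} {zero} _ = refl
lookup-injective (x∉xs ∷ _) {zero} {suc j} eq = contradiction eq (All.lookup x∉xs (∈-lookup j))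
lookup-injective (x∉xs ∷ _) {suc i} {zero} eq = contradiction (sym eq) (All.lookup x∉xs (∈-lookup i))
lookup-injective (_ ∷ xs-unique) {suc i} {suc j} eq = cong suc (lookup-injective xs-unique eq)

injective⇒surjective : ∀ {m n} {f : Fin m → Fin n} → n ≤ m → Injective _≡_ _≡_ f →
  ∀ i → ∃ λ j → f j ≡ i
injective⇒surjective {m} {ℕ.suc n} {f} n≤m f-injective i with any? (λ j → f j ≟ i)
... | yes hit = hit
... | no missed = contradiction (injective⇒≤ punched-injective) (<⇒≱ n≤m)
  where
  avoids : ∀ j → i ≢ f j
  avoids j i≡fj = missed (j , sym i≡fj)
  punched : Fin m → Fin n
  punched j = punchOut (avoids j)
  punched-injective : Injective _≡_ _≡_ punched
  punched-injective {j} {j′} = f-injective ∘ punchOut-injective (avoids j) (avoids j′)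

two-indices : ∀ {m} → 2 ≤ m → ∃₂ λ (i j : Fin m) → i ≢ j
two-indices (s≤s (s≤s _)) = zero , suc zero , λ ()

module _ {V : Set} (H : AbsGraph V) (_≟ⱽ_ : DecidableEquality V) where
  open AbsGraph H using (Adj; irr) renaming (sym to Adj-sym)

  maximal-absorbs : ∀ {S} → IsMaximalIndependent H S →
    ∀ x → (∀ y → T (S y) → ¬ Adj y x) → T (S x)
  maximal-absorbs {S} (S-independent , S-maximal) x x-free =
    S-maximal S⁺ S⁺-independent (λ y → into-S⁺ ∘ inj₁) x (into-S⁺ (inj₂ refl))
    where
    S⁺ : Subset H
    S⁺ y = S y ∨ ⌊ y ≟ⱽ x ⌋

    into-S⁺ : ∀ {y} → T (S y) ⊎ y ≡ x → T (S⁺ y)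
    into-S⁺ {y} = Equivalence.from (T-∨ {S y}) ∘ Sum.map₂ (fromWitness {a? = y ≟ⱽ x})

    ∈S⁺ : ∀ {y} → T (S⁺ y) → T (S y) ⊎ y ≡ x
    ∈S⁺ {y} = Sum.map₂ toWitness ∘ Equivalence.to (T-∨ {S y})

    S⁺-independent : IsIndependent H S⁺
    S⁺-independent y z y∈ z∈ with ∈S⁺ y∈ | ∈S⁺ z∈
    ... | inj₁ y∈S | inj₁ z∈S = S-independent y z y∈S z∈S
    ... | inj₁ y∈S | inj₂ refl = x-free y y∈S
    ... | inj₂ refl | inj₁ z∈S = x-free z z∈S ∘ Adj-sym
    ... | inj₂ refl | inj₂ refl = irr

  maximal-inhabited : ∀ {S} → IsMaximalIndependent H S →
    Dec (∃ λ x → T (S x)) → V → ∃ λ x → T (S x)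
  maximal-inhabited S-maximal (yes found) _ = found
  maximal-inhabited S-maximal (no empty) x =
    contradiction (x , maximal-absorbs S-maximal x λ y y∈S _ → empty (y , y∈S)) empty

module _ {n : ℕ} (G : Graph n) where
  open Graph G using (adj)

  L̄ : AbsGraph (Edge G)
  L̄ = LineComplement G

  open AbsGraph L̄ using (Adj)

  adj-sym : ∀ {u v} → T (adj u v) → T (adj v u)
  adj-sym {u} {v} = subst T (Graph.sym G u v)

  adj-irrefl : ∀ {v} → ¬ T (adj v v)
  adj-irrefl {v} = subst T (Graph.irr G v)

  data _∋_ (e : Edge G) (v : Fin n) : Set where
    end₁ : proj₁ (ends G e) ≡ v → e ∋ v
    end₂ : proj₂ (ends G e) ≡ v → e ∋ v

  _∋?_ : ∀ e v → Dec (e ∋ v)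
  e ∋? v = map′ [ end₁ , end₂ ]′ (λ { (end₁ p) → inj₁ p ; (end₂ p) → inj₂ p })
    ((proj₁ (ends G e) ≟ v) ⊎-dec (proj₂ (ends G e) ≟ v))

  ends-ordered : ∀ e → proj₁ (ends G e) < proj₂ (ends G e)
  ends-ordered (_ , a<b , _) = a<b

  ends-injective : ∀ {e f} → ends G e ≡ ends G f → e ≡ f
  ends-injective {(p , a<b , t)} {(.p , a<b′ , t′)} refl =
    cong₂ (λ l s → p , l , s) (<-irrelevant a<b a<b′) (T-irrelevant t t′)

  _≟ᴱ_ : DecidableEquality (Edge G)
  e ≟ᴱ f = map′ ends-injective (cong (ends G)) (≡-dec _≟_ _≟_ (ends G e) (ends G f))

  share? : ∀ e f → Dec (ShareEnd G e f)
  share? ((a , b) , _) ((c , d) , _) = (a ≟ c) ⊎-dec (a ≟ d) ⊎-dec (b ≟ c) ⊎-dec (b ≟ d)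

  ShareEnd⇒common : ∀ {e f} → ShareEnd G e f → ∃ λ v → e ∋ v × f ∋ v
  ShareEnd⇒common (inj₁ a≡c) = _ , end₁ refl , end₁ (sym a≡c)
  ShareEnd⇒common (inj₂ (inj₁ a≡d)) = _ , end₁ refl , end₂ (sym a≡d)
  ShareEnd⇒common (inj₂ (inj₂ (inj₁ b≡c))) = _ , end₂ refl , end₁ (sym b≡c)
  ShareEnd⇒common (inj₂ (inj₂ (inj₂ b≡d))) = _ , end₂ refl , end₂ (sym b≡d)

  common⇒ShareEnd : ∀ {e f v} → e ∋ v → f ∋ v → ShareEnd G e f
  common⇒ShareEnd (end₁ refl) (end₁ c≡a) = inj₁ (sym c≡a)
  common⇒ShareEnd (end₁ refl) (end₂ d≡a) = inj₂ (inj₁ (sym d≡a))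
  common⇒ShareEnd (end₂ refl) (end₁ c≡b) = inj₂ (inj₂ (inj₁ (sym c≡b)))
  common⇒ShareEnd (end₂ refl) (end₂ d≡b) = inj₂ (inj₂ (inj₂ (sym d≡b)))

  common⇒¬Adj : ∀ {e f v} → e ∋ v → f ∋ v → ¬ Adj e f
  common⇒¬Adj e∋v f∋v (_ , ¬share) = ¬share (common⇒ShareEnd e∋v f∋v)

  ¬Adj⇒common : ∀ {e f} → ¬ Adj e f → ∃ λ v → e ∋ v × f ∋ v
  ¬Adj⇒common {e} {f} ¬adj with e ≟ᴱ f | share? e f
  ... | yes refl | _ = _ , end₁ refl , end₁ refl
  ... | no _ | yes share = ShareEnd⇒common share
  ... | no e≢f | no ¬share = contradiction (e≢f ∘ ends-injective , ¬share) ¬adj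

  edge-adjacent : ∀ {e u v} → e ∋ u → e ∋ v → u ≢ v → T (adj u v)
  edge-adjacent (end₁ refl) (end₁ refl) u≢v = contradiction refl u≢v
  edge-adjacent {_ , _ , t} (end₁ refl) (end₂ refl) _ = t
  edge-adjacent {_ , _ , t} (end₂ refl) (end₁ refl) _ = adj-sym t
  edge-adjacent (end₂ refl) (end₂ refl) u≢v = contradiction refl u≢v

  other-end : ∀ {e v} → e ∋ v → ∃ λ w → e ∋ w × v ≢ w
  other-end {_ , a<b , _} (end₁ refl) = _ , end₂ refl , <⇒≢ a<b
  other-end {_ , a<b , _} (end₂ refl) = _ , end₁ refl , <⇒≢ a<b ∘ sym

  ∋-either : ∀ {e u v w} → e ∋ u → e ∋ v → u ≢ v → e ∋ w → u ≡ w ⊎ v ≡ w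
  ∋-either (end₁ refl) (end₁ refl) u≢v _ = contradiction refl u≢v
  ∋-either (end₁ refl) (end₂ refl) _ (end₁ u≡w) = inj₁ u≡w
  ∋-either (end₁ refl) (end₂ refl) _ (end₂ v≡w) = inj₂ v≡w
  ∋-either (end₂ refl) (end₁ refl) _ (end₁ v≡w) = inj₂ v≡w
  ∋-either (end₂ refl) (end₁ refl) _ (end₂ u≡w) = inj₁ u≡w
  ∋-either (end₂ refl) (end₂ refl) u≢v _ = contradiction refl u≢v

  ∋-ends : ∀ {e u v} → e ∋ u → e ∋ v → u ≢ v → ends G e ≡ (u , v) ⊎ ends G e ≡ (v , u)
  ∋-ends (end₁ refl) (end₁ refl) u≢v = contradiction refl u≢v
  ∋-ends (end₁ refl) (end₂ refl) _ = inj₁ refl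
  ∋-ends (end₂ refl) (end₁ refl) _ = inj₂ refl
  ∋-ends (end₂ refl) (end₂ refl) u≢v = contradiction refl u≢v

  ends-uncrossed : ∀ {e f u v} → ends G e ≡ (u , v) → ends G f ≡ (v , u) → ⊥
  ends-uncrossed {e} {f} e-uv f-vu = <-asym (ordered e-uv (ends-ordered e)) (ordered f-vu (ends-ordered f))
    where ordered = subst (λ p → proj₁ p < proj₂ p)

  same-ends : ∀ {e f u v} → e ∋ u → e ∋ v → f ∋ u → f ∋ v → u ≢ v → e ≡ f
  same-ends {e} {f} e∋u e∋v f∋u f∋v u≢v with ∋-ends e∋u e∋v u≢v | ∋-ends f∋u f∋v u≢v
  ... | inj₁ e-uv | inj₁ f-uv = ends-injective (trans e-uv (sym f-uv))
  ... | inj₂ e-vu | inj₂ f-vu = ends-injective (trans e-vu (sym f-vu))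
  ... | inj₁ e-uv | inj₂ f-vu = ⊥-elim (ends-uncrossed {e} {f} e-uv f-vu)
  ... | inj₂ e-vu | inj₁ f-uv = ⊥-elim (ends-uncrossed {f} {e} f-uv e-vu)

  meets-other-end : ∀ {p e u w} → ¬ Adj p e → e ∋ u → e ∋ w → u ≢ w → ¬ p ∋ u → p ∋ w
  meets-other-end ¬adj e∋u e∋w u≢w p∌u with ¬Adj⇒common ¬adj
  ... | z , p∋z , e∋z with ∋-either e∋u e∋w u≢w e∋z
  ...   | inj₁ refl = contradiction p∋z p∌u
  ...   | inj₂ refl = p∋z

  mkEdge : ∀ u v → T (adj u v) → Edge G
  mkEdge u v t with <-cmp u v
  ... | tri< u<v _ _ = (u , v) , u<v , t
  ... | tri≈ _ refl _ = ⊥-elim (adj-irrefl t)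
  ... | tri> _ _ v<u = (v , u) , v<u , adj-sym t

  mkEdge-∋ : ∀ u v t → mkEdge u v t ∋ u × mkEdge u v t ∋ v
  mkEdge-∋ u v t with <-cmp u v
  ... | tri< _ _ _ = end₁ refl , end₂ refl
  ... | tri≈ _ refl _ = ⊥-elim (adj-irrefl t)
  ... | tri> _ _ _ = end₂ refl , end₁ refl

  adjacent? : ∀ v u → Dec (adj v u ≡ true)
  adjacent? v u = adj v u Bool.≟ true

  neighbours : Fin n → List (Fin n)
  neighbours v = filter (adjacent? v) (allFin n)

  neighbour : ∀ v → Fin (degree G v) → Fin n
  neighbour v = lookup (neighbours v)

  neighbour-adjacent : ∀ v j → T (adj v (neighbour v j))
  neighbour-adjacent v j = Equivalence.from T-≡ (proj₂ (∈-filter⁻ (adjacent? v) {xs = allFin n} (∈-lookup j)))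

  neighbour-injective : ∀ v → Injective _≡_ _≡_ (neighbour v)
  neighbour-injective v = lookup-injective (filter⁺ (adjacent? v) (allFin⁺ n))

  neighbour-surjective : ∀ {v w} → T (adj v w) → ∃ λ j → neighbour v j ≡ w
  neighbour-surjective {v} {w} t = Any.index w∈ , sym (lookup-index w∈)
    where w∈ = ∈-filter⁺ (adjacent? v) (∈-allFin w) (Equivalence.to T-≡ t)

  spoke : ∀ v → Fin (degree G v) → Edge G
  spoke v j = mkEdge v (neighbour v j) (neighbour-adjacent v j)

  spoke-∋-centre : ∀ v j → spoke v j ∋ v
  spoke-∋-centre v j = proj₁ (mkEdge-∋ v (neighbour v j) (neighbour-adjacent v j))

  spoke-∋-neighbour : ∀ v j → spoke v j ∋ neighbour v j
  spoke-∋-neighbour v j = proj₂ (mkEdge-∋ v (neighbour v j) (neighbour-adjacent v j))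

  centre≢neighbour : ∀ v j → v ≢ neighbour v j
  centre≢neighbour v j v≡ = adj-irrefl (subst (λ u → T (adj v u)) (sym v≡) (neighbour-adjacent v j))

  spoke-injective : ∀ v → Injective _≡_ _≡_ (spoke v)
  spoke-injective v {i} {j} spokes≡
    with ∋-either (spoke-∋-centre v j) (spoke-∋-neighbour v j) (centre≢neighbour v j)
                  (subst (_∋ neighbour v i) spokes≡ (spoke-∋-neighbour v i))
  ... | inj₁ v≡ = contradiction v≡ (centre≢neighbour v i)
  ... | inj₂ neighbours≡ = neighbour-injective v (sym neighbours≡)

  spoke-surjective : ∀ {e v} → e ∋ v → ∃ λ j → spoke v j ≡ e
  spoke-surjective {v = v} e∋v with other-end e∋v
  ... | w , e∋w , v≢w with neighbour-surjective (edge-adjacent e∋v e∋w v≢w)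
  ...   | j , refl = j , same-ends (spoke-∋-centre v j) (spoke-∋-neighbour v j) e∋v e∋w v≢w

  any-edge? : ∀ {P : Edge G → Set} → Decidable P → Dec (∃ P)
  any-edge? {P} P? = map′ (λ (v , j , p) → spoke v j , p) from-spoke (any? λ v → any? λ j → P? (spoke v j))
    where
    from-spoke : ∃ P → ∃ λ v → ∃ λ j → P (spoke v j)
    from-spoke (e , pe) =
      let j , spoke≡e = spoke-surjective (end₁ {e} refl) in _ , j , subst P (sym spoke≡e) pe

  star : Fin n → Subset L̄
  star v e = ⌊ e ∋? v ⌋

  star-maximal : TriangleFree G → ∀ {v} → 2 ≤ degree G v → IsMaximalIndependent L̄ (star v)
  star-maximal triangle-free {v} 2≤deg = star-independent , star-closed
    where
    star-independent : IsIndependent L̄ (star v)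
    star-independent e f e∈ f∈ = common⇒¬Adj (toWitness e∈) (toWitness f∈)

    star-closed : ∀ S → IsIndependent L̄ S → _⊆_ L̄ (star v) S → _⊆_ L̄ S (star v)
    star-closed S S-independent star⊆S x x∈S = fromWitness (decidable-stable (x ∋? v) x-at-centre)
      where
      through-neighbour : ¬ x ∋ v → ∀ j → x ∋ neighbour v j
      through-neighbour x∌v j =
        meets-other-end
          (S-independent x (spoke v j) x∈S (star⊆S (spoke v j) (fromWitness (spoke-∋-centre v j))))
          (spoke-∋-centre v j) (spoke-∋-neighbour v j) (centre≢neighbour v j) x∌v

      x-at-centre : ¬ ¬ x ∋ v
      x-at-centre x∌v =
        let i , j , i≢j = two-indices 2≤deg
        in triangle-free v (neighbour v i) (neighbour v j)
             ( neighbour-adjacent v i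
             , edge-adjacent (through-neighbour x∌v i) (through-neighbour x∌v j) (i≢j ∘ neighbour-injective v)
             , neighbour-adjacent v j )

  absorbs-one-end : TriangleFree G → ∀ {S} → IsMaximalIndependent L̄ S →
    ∀ {e x y} → T (S e) → x ∋ proj₁ (ends G e) → y ∋ proj₂ (ends G e) → T (S x) ⊎ T (S y)
  absorbs-one-end triangle-free {S} S-maximal@(S-independent , _) {e} {x} {y} e∈S x∋a y∋b
    with T? (S x) | T? (S y)
  ... | yes x∈S | _ = inj₁ x∈S
  ... | no _ | yes y∈S = inj₂ y∈S
  ... | no x∉S | no y∉S =
    ⊥-elim (x∉S (maximal-absorbs L̄ _≟ᴱ_ S-maximal x λ p p∈S p~x →
                 y∉S (maximal-absorbs L̄ _≟ᴱ_ S-maximal y λ q q∈S q~y →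
                      triangle p∈S p~x q∈S q~y)))
    where
    a = proj₁ (ends G e)
    b = proj₂ (ends G e)
    a≢b = <⇒≢ (ends-ordered e)
    e∋a : e ∋ a
    e∋a = end₁ refl
    e∋b : e ∋ b
    e∋b = end₂ refl

    -- p avoids a, so it meets e at b; q likewise meets e at a; and p, q meet at a third vertex.
    triangle : ∀ {p q} → T (S p) → Adj p x → T (S q) → Adj q y → ⊥
    triangle {p} {q} p∈S p~x q∈S q~y =
      triangle-free a b z (proj₂ (proj₂ e) , edge-adjacent p∋b p∋z b≢z , edge-adjacent q∋a q∋z a≢z)
      where
      p∌a : ¬ p ∋ a
      p∌a p∋a = common⇒¬Adj p∋a x∋a p~x
      q∌b : ¬ q ∋ b
      q∌b q∋b = common⇒¬Adj q∋b y∋b q~y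
      p∋b : p ∋ b
      p∋b = meets-other-end (S-independent p e p∈S e∈S) e∋a e∋b a≢b p∌a
      q∋a : q ∋ a
      q∋a = meets-other-end (S-independent q e q∈S e∈S) e∋b e∋a (a≢b ∘ sym) q∌b
      pq-common = ¬Adj⇒common (S-independent p q p∈S q∈S)
      z = proj₁ pq-common
      p∋z = proj₁ (proj₂ pq-common)
      q∋z = proj₂ (proj₂ pq-common)
      b≢z : b ≢ z
      b≢z b≡z = q∌b (subst (q ∋_) (sym b≡z) q∋z)
      a≢z : a ≢ z
      a≢z a≡z = p∌a (subst (p ∋_) (sym a≡z) p∋z)

  module _ {k : ℕ} (colour : Edge G → Fin k)
           (proper : ∀ e f → ¬ (ends G e ≡ ends G f) → ShareEnd G e f → ¬ (colour e ≡ colour f)) where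

    colour-at : IsRegular G k → ∀ v i → ∃ λ e → e ∋ v × colour e ≡ i
    colour-at regular v i =
      let j , colour≡i = injective⇒surjective (≤-reflexive (sym (regular v))) spoke-colour-injective i
      in spoke v j , spoke-∋-centre v j , colour≡i
      where
      spoke-colour-injective : Injective _≡_ _≡_ (colour ∘ spoke v)
      spoke-colour-injective {i} {j} same-colour = decidable-stable (i ≟ j) λ i≢j →
        proper (spoke v i) (spoke v j) (i≢j ∘ spoke-injective v ∘ ends-injective)
          (common⇒ShareEnd (spoke-∋-centre v i) (spoke-∋-centre v j)) same-colour

    colourClass : Fin k → Subset L̄
    colourClass i e = ⌊ colour e ≟ i ⌋

    -- The vertex only serves to provide an edge, so that maximal independent sets are nonempty.
    colourClass-strong : TriangleFree G → IsRegular G k → Fin n → ∀ i → IsStrongClique L̄ (colourClass i)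
    colourClass-strong triangle-free regular v i = clique , meets
      where
      clique : IsClique L̄ (colourClass i)
      clique e f e∈i f∈i e≢f = ends≢ , λ share → proper e f ends≢ share (trans (toWitness e∈i) (sym (toWitness f∈i)))
        where ends≢ = e≢f ∘ ends-injective

      meets : ∀ S → IsMaximalIndependent L̄ S → ∃ λ x → T (colourClass i x) × T (S x)
      meets S S-maximal with maximal-inhabited L̄ _≟ᴱ_ S-maximal (any-edge? (T? ∘ S)) (proj₁ (colour-at regular v i))
      ... | e , e∈S with colour-at regular (proj₁ (ends G e)) i | colour-at regular (proj₂ (ends G e)) i
      ...   | x , x∋a , x-coloured | y , y∋b , y-coloured with absorbs-one-end triangle-free S-maximal {e} e∈S x∋a y∋b
      ...     | inj₁ x∈S = x , fromWitness x-coloured , x∈S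
      ...     | inj₂ y∈S = y , fromWitness y-coloured , y∈S

  colourable⇒localizable : TriangleFree G → ∀ {k} → IsRegular G k → Fin n →
    EdgeColorable G k → Localizable L̄
  colourable⇒localizable triangle-free {k} regular v (colour , proper) =
    k , colour , colourClass-strong colour proper triangle-free regular v

  localizable⇒colourable : TriangleFree G → ∀ {v} → 2 ≤ degree G v →
    Localizable L̄ → EdgeColorable G (degree G v)
  localizable⇒colourable triangle-free {v} 2≤deg (m , part , strong) = colour , proper
    where
    meets-star : ∀ i → ∃ λ j → part (spoke v j) ≡ i
    meets-star i =
      let e , e∈i , e∈star = proj₂ (strong i) (star v) (star-maximal triangle-free 2≤deg)
          j , spoke≡e = spoke-surjective {e} (toWitness e∈star)
      in j , trans (cong part spoke≡e) (toWitness e∈i)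

    colour : Edge G → Fin (degree G v)
    colour e = proj₁ (meets-star (part e))

    proper : ∀ e f → ¬ (ends G e ≡ ends G f) → ShareEnd G e f → ¬ (colour e ≡ colour f)
    proper e f ends≢ share same-colour =
      proj₂ (proj₁ (strong (part e)) e f (fromWitness refl) (fromWitness (sym same-part)) (ends≢ ∘ cong (ends G))) share
      where
      open ≡-Reasoning
      same-part : part e ≡ part f
      same-part = begin
        part e                      ≡⟨ sym (proj₂ (meets-star (part e))) ⟩
        part (spoke v (colour e))   ≡⟨ cong (part ∘ spoke v) same-colour ⟩
        part (spoke v (colour f))   ≡⟨ proj₂ (meets-star (part f)) ⟩
        part f                      ∎

lemma5p8 : (k : ℕ) → 2 ≤ k → (n : ℕ) → (G : Graph n) →
    TriangleFree G → IsRegular G k →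
    (EdgeColorable G k → Localizable (LineComplement G)) ×
    (Localizable (LineComplement G) → EdgeColorable G k)
lemma5p8 k 2≤k ℕ.zero G triangle-free regular =
  (λ _ → 0 , (λ { ((() , _) , _) }) , λ ()) ,
  (λ _ → (λ { ((() , _) , _) }) , λ { ((() , _) , _) })
lemma5p8 k 2≤k (ℕ.suc n) G triangle-free regular =
  colourable⇒localizable G triangle-free regular zero ,
  subst (EdgeColorable G) (regular zero)
    ∘ localizable⇒colourable G triangle-free (subst (2 ≤_) (sym (regular zero)) 2≤k)
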